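{- Let $U_N(x)$ denote the Chebyshev polynomial of the second kind of degree $N$. For all integers $1\le k\le n$, the absolute value of the coefficient of $x^{n-k}$ in $U_{n+k-2}(x)$ equals the number of words of length $n-1$ over the alphabet $\{0,1,2\}$ having exactly $k-1$ letters equal to $2$. -}

module Defs where

open import Data.Nat using (ℕ; zero; suc)
open import Data.Integer using (ℤ; +_; -_; _+_; _*_)
open import Data.Fin using (Fin; zero; suc)
open import Data.Vec using (Vec; []; _∷_)
open import Data.List using (List; []; _∷_; map; concatMap; length; filter)
open import Relation.Binary.PropositionalEquality using (_≡_)
open import Data.Nat using (_≟_)

-- Polynomials with integer coefficients as coefficient lists,
-- lowest degree first: a₀ ∷ a₁ ∷ … represents a₀ + a₁ x + …
Poly : Set
Poly = List ℤ

coeff : Poly → ℕ → ℤ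
coeff []       _       = + 0
coeff (a ∷ p)  zero    = a
coeff (a ∷ p)  (suc i) = coeff p i

_⊕_ : Poly → Poly → Poly
[]      ⊕ q       = q
(a ∷ p) ⊕ []      = a ∷ p
(a ∷ p) ⊕ (b ∷ q) = (a + b) ∷ (p ⊕ q)

neg : Poly → Poly
neg = map -_

twoX : Poly → Poly
twoX p = + 0 ∷ map (λ a → + 2 * a) p

chebU : ℕ → Poly
chebU zero          = + 1 ∷ []
chebU (suc zero)    = + 0 ∷ + 2 ∷ []
chebU (suc (suc N)) = twoX (chebU (suc N)) ⊕ neg (chebU N)

words : (m : ℕ) → List (Vec (Fin 3) m)
words zero    = [] ∷ []
words (suc m) = concatMap (λ w → map (λ c → c ∷ w) (zero ∷ suc zero ∷ suc (suc zero) ∷ [])) (words m)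

twos : {m : ℕ} → Vec (Fin 3) m → ℕ
twos []                    = 0
twos (suc (suc zero) ∷ w)  = suc (twos w)
twos (_ ∷ w)               = twos w

countWords : ℕ → ℕ → ℕ
countWords m j = length (filter (λ w → twos w ≟ j) (words m))

-- Write j = k − 1 and d = n − k, so the claim concerns the coefficient c j d of x^d in
-- U_{2j+d} and the number w j d of words of length j + d with j twos. Reading off x^{d+1}
-- in U_{N+2} = 2x U_{N+1} − U_N gives c (j+1) (d+1) = 2 c (j+1) d − c j (d+1), and
-- splitting a word on its first letter gives w (j+1) (d+1) = 2 w (j+1) d + w j (d+1).
-- The boundary values agree up to sign as well: c 0 d = 2^d = w 0 d, and
-- c (j+1) 0 = − c j 0 while w (j+1) 0 = w j 0. Hence c j d = (−1)^j w j d.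
module Submission where

open import Defs
open import Data.Nat using (ℕ; zero; suc; _+_; _*_; _∸_; _≤_; _<_; s≤s; _≟_; _≡ᵇ_)
open import Data.Nat.Properties
  using (+-identityʳ; +-suc; ≤-reflexive; <⇒≤; n<1+n; m<n⇒m<1+n; m+n∸m≡n; m≤n⇒∃[o]m+o≡n)
open import Data.Nat.Solver using (module +-*-Solver)
open import Data.Integer using (ℤ; +_; -_; ∣_∣) renaming (_+_ to _+ℤ_; _*_ to _*ℤ_; _-_ to _-ℤ_)
import Data.Integer.Properties as ℤ
open import Data.Fin using (Fin) renaming (zero to 0F; suc to sucF)
open import Data.Vec using (Vec; _∷_)
open import Data.List using (List; []; _∷_; _++_; [_]; map; concatMap; length; filter)
open import Data.List.Properties using (length-++; filter-++; filter-accept; filter-reject)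
open import Data.Bool using (true; false)
open import Data.Product using (_,_)
open import Function using (_∘_)
open import Relation.Nullary using (Dec; yes; no)
open import Relation.Binary.PropositionalEquality
  using (_≡_; refl; sym; trans; cong; cong₂; module ≡-Reasoning)
open ≡-Reasoning

coeff-⊕ : ∀ p q i → coeff (p ⊕ q) i ≡ coeff p i +ℤ coeff q i
coeff-⊕ []      q       i       = sym (ℤ.+-identityˡ (coeff q i))
coeff-⊕ (a ∷ p) []      zero    = sym (ℤ.+-identityʳ a)
coeff-⊕ (a ∷ p) []      (suc i) = sym (ℤ.+-identityʳ (coeff p i))
coeff-⊕ (a ∷ p) (b ∷ q) zero    = refl
coeff-⊕ (a ∷ p) (b ∷ q) (suc i) = coeff-⊕ p q i

coeff-map : ∀ (f : ℤ → ℤ) → f (+ 0) ≡ + 0 → ∀ p i → coeff (map f p) i ≡ f (coeff p i)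
coeff-map f f0≡0 []      i       = sym f0≡0
coeff-map f f0≡0 (a ∷ p) zero    = refl
coeff-map f f0≡0 (a ∷ p) (suc i) = coeff-map f f0≡0 p i

coeff-chebU-zero : ∀ N → coeff (chebU (suc (suc N))) 0 ≡ - coeff (chebU N) 0
coeff-chebU-zero N = begin
  coeff (twoX (chebU (suc N)) ⊕ neg (chebU N)) 0  ≡⟨ coeff-⊕ (twoX (chebU (suc N))) (neg (chebU N)) 0 ⟩
  + 0 +ℤ coeff (neg (chebU N)) 0                  ≡⟨ ℤ.+-identityˡ _ ⟩
  coeff (neg (chebU N)) 0                         ≡⟨ coeff-map -_ refl (chebU N) 0 ⟩
  - coeff (chebU N) 0                             ∎

coeff-chebU-suc : ∀ N i →
  coeff (chebU (suc (suc N))) (suc i) ≡ + 2 *ℤ coeff (chebU (suc N)) i -ℤ coeff (chebU N) (suc i)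
coeff-chebU-suc N i = trans (coeff-⊕ (twoX (chebU (suc N))) (neg (chebU N)) (suc i))
  (cong₂ _+ℤ_ (coeff-map (+ 2 *ℤ_) refl (chebU (suc N)) i) (coeff-map -_ refl (chebU N) (suc i)))

coeff-chebU-vanishes : ∀ N i → N < i → coeff (chebU N) i ≡ + 0
coeff-chebU-vanishes zero          (suc i)       _       = refl
coeff-chebU-vanishes (suc zero)    (suc zero)    (s≤s ())
coeff-chebU-vanishes (suc zero)    (suc (suc i)) _       = refl
coeff-chebU-vanishes (suc (suc N)) (suc i)       (s≤s N<i) = begin
  coeff (chebU (suc (suc N))) (suc i)                                  ≡⟨ coeff-chebU-suc N i ⟩
  + 2 *ℤ coeff (chebU (suc N)) i -ℤ coeff (chebU N) (suc i)
    ≡⟨ cong₂ (λ a b → + 2 *ℤ a -ℤ b) (coeff-chebU-vanishes (suc N) i N<i)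
                                     (coeff-chebU-vanishes N (suc i) (m<n⇒m<1+n (<⇒≤ N<i))) ⟩
  + 0                                                                  ∎

twos≟ : ∀ {m} j (w : Vec (Fin 3) m) → Dec (twos w ≡ j)
twos≟ j w = twos w ≟ j

count : ∀ {m} → ℕ → List (Vec (Fin 3) m) → ℕ
count j ws = length (filter (twos≟ j) ws)

count-++ : ∀ {m} j (vs ws : List (Vec (Fin 3) m)) → count j (vs ++ ws) ≡ count j vs + count j ws
count-++ j vs ws = trans (cong length (filter-++ (twos≟ j) vs ws)) (length-++ (filter _ vs))

count-∷ : ∀ {m} j (v : Vec (Fin 3) m) ws → count j (v ∷ ws) ≡ count j [ v ] + count j ws
count-∷ j v = count-++ j [ v ]

two : Fin 3
two = sucF (sucF 0F)

extensions : ∀ {m} → Vec (Fin 3) m → List (Vec (Fin 3) (suc m))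
extensions w = map (_∷ w) (0F ∷ sucF 0F ∷ two ∷ [])

count-[]-twos : ∀ {m n} j (v : Vec (Fin 3) m) (w : Vec (Fin 3) n) →
  twos v ≡ twos w → count j [ v ] ≡ count j [ w ]
count-[]-twos j v w v≡w with twos w ≟ j
... | yes w≡j = trans (cong length (filter-accept (twos≟ j) {v} {[]} (trans v≡w w≡j)))
                      (sym (cong length (filter-accept (twos≟ j) {w} {[]} w≡j)))
... | no  w≢j = trans (cong length (filter-reject (twos≟ j) {v} {[]} (w≢j ∘ trans (sym v≡w))))
                      (sym (cong length (filter-reject (twos≟ j) {w} {[]} w≢j)))

count-extensions : ∀ {m} j (w : Vec (Fin 3) m) →
  count j (extensions w) ≡ count j [ w ] + (count j [ w ] + count j [ two ∷ w ])
count-extensions j w = begin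
  count j (extensions w)
    ≡⟨ count-∷ j (0F ∷ w) _ ⟩
  count j [ 0F ∷ w ] + count j ((sucF 0F ∷ w) ∷ [ two ∷ w ])
    ≡⟨ cong (λ n → count j [ 0F ∷ w ] + n) (count-∷ j (sucF 0F ∷ w) _) ⟩
  count j [ 0F ∷ w ] + (count j [ sucF 0F ∷ w ] + count j [ two ∷ w ])
    ≡⟨ cong₂ (λ a b → a + (b + count j [ two ∷ w ]))
             (count-[]-twos j (0F ∷ w) w refl) (count-[]-twos j (sucF 0F ∷ w) w refl) ⟩
  count j [ w ] + (count j [ w ] + count j [ two ∷ w ])
    ∎

count-concatMap-extensions : ∀ {m} j (ws : List (Vec (Fin 3) m)) →
  count j (concatMap extensions ws) ≡ 2 * count j ws + count j (map (two ∷_) ws)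
count-concatMap-extensions j []       = refl
count-concatMap-extensions j (w ∷ ws) = begin
  count j (extensions w ++ concatMap extensions ws)
    ≡⟨ count-++ j (extensions w) _ ⟩
  count j (extensions w) + count j (concatMap extensions ws)
    ≡⟨ cong₂ _+_ (count-extensions j w) (count-concatMap-extensions j ws) ⟩
  (a + (a + t)) + (2 * b + u)
    ≡⟨ solve 4 (λ a t b u → (a :+ (a :+ t)) :+ (con 2 :* b :+ u) := con 2 :* (a :+ b) :+ (t :+ u)) refl a t b u ⟩
  2 * (a + b) + (t + u)
    ≡⟨ sym (cong₂ (λ x y → 2 * x + y) (count-∷ j w ws) (count-∷ j (two ∷ w) _)) ⟩
  2 * count j (w ∷ ws) + count j (map (two ∷_) (w ∷ ws))
    ∎
  where
  open +-*-Solver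
  a = count j [ w ]
  t = count j [ two ∷ w ]
  b = count j ws
  u = count j (map (two ∷_) ws)

count-zero-two∷ : ∀ {m} (ws : List (Vec (Fin 3) m)) → count 0 (map (two ∷_) ws) ≡ 0
count-zero-two∷ []       = refl
count-zero-two∷ (w ∷ ws) = count-zero-two∷ ws

count-suc-two∷ : ∀ {m} j (ws : List (Vec (Fin 3) m)) → count (suc j) (map (two ∷_) ws) ≡ count j ws
count-suc-two∷ j []       = refl
count-suc-two∷ j (w ∷ ws) with twos w ≡ᵇ j
... | true  = cong suc (count-suc-two∷ j ws)
... | false = count-suc-two∷ j ws

countWords-suc-zero : ∀ m → countWords (suc m) 0 ≡ 2 * countWords m 0
countWords-suc-zero m = begin
  count 0 (concatMap extensions (words m))                 ≡⟨ count-concatMap-extensions 0 (words m) ⟩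
  2 * countWords m 0 + count 0 (map (two ∷_) (words m))   ≡⟨ cong (λ n → 2 * countWords m 0 + n) (count-zero-two∷ (words m)) ⟩
  2 * countWords m 0 + 0                                   ≡⟨ +-identityʳ _ ⟩
  2 * countWords m 0                                       ∎

countWords-suc-suc : ∀ m j → countWords (suc m) (suc j) ≡ 2 * countWords m (suc j) + countWords m j
countWords-suc-suc m j = trans (count-concatMap-extensions (suc j) (words m))
  (cong (λ n → 2 * countWords m (suc j) + n) (count-suc-two∷ j (words m)))

countWords-vanishes : ∀ m j → m < j → countWords m j ≡ 0
countWords-vanishes zero    (suc j) _         = refl
countWords-vanishes (suc m) (suc j) (s≤s m<j) = trans (countWords-suc-suc m j)
  (cong₂ (λ a b → 2 * a + b) (countWords-vanishes m (suc j) (m<n⇒m<1+n m<j)) (countWords-vanishes m j m<j))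

countWords-suc-suc-≤ : ∀ m j → m ≤ j → countWords (suc m) (suc j) ≡ countWords m j
countWords-suc-suc-≤ m j m≤j = trans (countWords-suc-suc m j)
  (cong (λ a → 2 * a + countWords m j) (countWords-vanishes m (suc j) (s≤s m≤j)))

signed : ℕ → ℤ → ℤ
signed zero    x = x
signed (suc j) x = - signed j x

∣signed∣ : ∀ j x → ∣ signed j x ∣ ≡ ∣ x ∣
∣signed∣ zero    x = refl
∣signed∣ (suc j) x = trans (ℤ.∣-i∣≡∣i∣ (signed j x)) (∣signed∣ j x)

signed-linear : ∀ j a x y → + a *ℤ signed j (+ x) +ℤ signed j (+ y) ≡ signed j (+ (a * x + y))
signed-linear zero    a x y = sym (trans (ℤ.pos-+ (a * x) y) (cong (_+ℤ + y) (ℤ.pos-* a x)))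
signed-linear (suc j) a x y = begin
  + a *ℤ - signed j (+ x) +ℤ - signed j (+ y)   ≡⟨ cong (_+ℤ - signed j (+ y)) (sym (ℤ.neg-distribʳ-* (+ a) (signed j (+ x)))) ⟩
  - (+ a *ℤ signed j (+ x)) +ℤ - signed j (+ y) ≡⟨ sym (ℤ.neg-distrib-+ (+ a *ℤ signed j (+ x)) (signed j (+ y))) ⟩
  - (+ a *ℤ signed j (+ x) +ℤ signed j (+ y))   ≡⟨ cong -_ (signed-linear j a x y) ⟩
  - signed j (+ (a * x + y))                    ∎

-- double+ j d = 2j + d, by recursion on j so that chebU (double+ (suc j) d) unfolds
-- one step of the Chebyshev recurrence.
double+ : ℕ → ℕ → ℕ
double+ zero    d = d
double+ (suc j) d = suc (suc (double+ j d))

double+-suc : ∀ j d → double+ j (suc d) ≡ suc (double+ j d)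
double+-suc zero    d = refl
double+-suc (suc j) d = cong (suc ∘ suc) (double+-suc j d)

double+≡ : ∀ j d → double+ j d ≡ j + d + j
double+≡ zero    d = sym (+-identityʳ d)
double+≡ (suc j) d = cong suc (trans (cong suc (double+≡ j d)) (sym (+-suc (j + d) j)))

coeff-chebU-double+ : ∀ j d → coeff (chebU (double+ j d)) d ≡ signed j (+ countWords (j + d) j)
coeff-chebU-double+ zero    zero          = refl
coeff-chebU-double+ zero    (suc zero)    = refl
coeff-chebU-double+ zero    (suc (suc d)) = begin
  coeff (chebU (suc (suc d))) (suc (suc d))
    ≡⟨ coeff-chebU-suc d (suc d) ⟩
  + 2 *ℤ coeff (chebU (suc d)) (suc d) -ℤ coeff (chebU d) (suc (suc d))
    ≡⟨ cong₂ (λ a b → + 2 *ℤ a -ℤ b) (coeff-chebU-double+ zero (suc d))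
                                     (coeff-chebU-vanishes d (suc (suc d)) (m<n⇒m<1+n (n<1+n d))) ⟩
  + 2 *ℤ + countWords (suc d) 0 +ℤ + 0
    ≡⟨ signed-linear zero 2 (countWords (suc d) 0) 0 ⟩
  + (2 * countWords (suc d) 0 + 0)
    ≡⟨ cong +_ (trans (+-identityʳ _) (sym (countWords-suc-zero (suc d)))) ⟩
  + countWords (suc (suc d)) 0
    ∎
coeff-chebU-double+ (suc j) zero = begin
  coeff (chebU (double+ (suc j) 0)) 0  ≡⟨ coeff-chebU-zero (double+ j 0) ⟩
  - coeff (chebU (double+ j 0)) 0      ≡⟨ cong -_ (coeff-chebU-double+ j 0) ⟩
  - signed j (+ countWords (j + 0) j)
    ≡⟨ cong (λ n → - signed j (+ n)) (sym (countWords-suc-suc-≤ (j + 0) j (≤-reflexive (+-identityʳ j)))) ⟩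
  - signed j (+ countWords (suc j + 0) (suc j))
    ∎
coeff-chebU-double+ (suc j) (suc d) = begin
  coeff (chebU (suc (suc (double+ j (suc d))))) (suc d)
    ≡⟨ coeff-chebU-suc (double+ j (suc d)) d ⟩
  + 2 *ℤ coeff (chebU (suc (double+ j (suc d)))) d -ℤ coeff (chebU (double+ j (suc d))) (suc d)
    ≡⟨ cong (λ N → + 2 *ℤ coeff (chebU (suc N)) d -ℤ coeff (chebU (double+ j (suc d))) (suc d)) (double+-suc j d) ⟩
  + 2 *ℤ coeff (chebU (double+ (suc j) d)) d -ℤ coeff (chebU (double+ j (suc d))) (suc d)
    ≡⟨ cong₂ (λ a b → + 2 *ℤ a -ℤ b) (coeff-chebU-double+ (suc j) d) (coeff-chebU-double+ j (suc d)) ⟩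
  + 2 *ℤ signed (suc j) (+ countWords (suc (j + d)) (suc j)) +ℤ signed (suc j) (+ countWords (j + suc d) j)
    ≡⟨ cong (λ m → + 2 *ℤ signed (suc j) (+ countWords m (suc j)) +ℤ signed (suc j) (+ countWords (j + suc d) j))
            (sym (+-suc j d)) ⟩
  + 2 *ℤ signed (suc j) (+ countWords (j + suc d) (suc j)) +ℤ signed (suc j) (+ countWords (j + suc d) j)
    ≡⟨ signed-linear (suc j) 2 _ _ ⟩
  signed (suc j) (+ (2 * countWords (j + suc d) (suc j) + countWords (j + suc d) j))
    ≡⟨ cong (λ n → signed (suc j) (+ n)) (sym (countWords-suc-suc (j + suc d) j)) ⟩
  signed (suc j) (+ countWords (suc j + suc d) (suc j))
    ∎

corollary18 : (n k : ℕ) → 1 ≤ k → k ≤ n →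
    ∣ coeff (chebU (n + k ∸ 2)) (n ∸ k) ∣ ≡ countWords (n ∸ 1) (k ∸ 1)
corollary18 (suc m) (suc j) _ (s≤s j≤m) with m≤n⇒∃[o]m+o≡n j≤m
... | d , refl = begin
  ∣ coeff (chebU (j + d + suc j ∸ 1)) (j + d ∸ j) ∣
    ≡⟨ cong₂ (λ N i → ∣ coeff (chebU N) i ∣) degree (m+n∸m≡n j d) ⟩
  ∣ coeff (chebU (double+ j d)) d ∣  ≡⟨ cong ∣_∣ (coeff-chebU-double+ j d) ⟩
  ∣ signed j (+ countWords (j + d) j) ∣  ≡⟨ ∣signed∣ j _ ⟩
  countWords (j + d) j               ∎
  where
  degree : j + d + suc j ∸ 1 ≡ double+ j d
  degree = trans (cong (_∸ 1) (+-suc (j + d) j)) (sym (double+≡ j d))
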